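{- For every $n\geq0$ the matrix $([i+j]!_q)_{0\leq i,j\leq n}$ has special Smith normal form $\mathrm{diag}\big(1,q^{1^2}[1]!_q^2,q^{2^2}[2]!_q^2,\ldots,q^{n^2}[n]!_q^2\big)$ over $\mathbb{Z}[q]$.
   Context: $[k]_q=1+q+\cdots+q^{k-1}$, $[k]!_q=[1]_q\cdots[k]_q$, $[0]!_q=1$. For an $m\times n$ matrix $A$ over a commutative ring $R$, a matrix $D$ is a special Smith normal form (SSNF) of $A$ over $R$ if there exist $P\in \mathrm{SL}(m,R)$, $Q\in\mathrm{SL}(n,R)$ with $PAQ=D$, $D$ is diagonal, and $d_{ii}$ is a multiple in $R$ of $d_{jj}$ whenever $i\geq j$. -}

module Defs where

open import Data.Nat using (ℕ; zero; suc; _≤_) renaming (_+_ to _+ℕ_; _*_ to _*ℕ_)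
open import Data.Integer using (ℤ; 0ℤ; 1ℤ) renaming (_+_ to _+ℤ_; _*_ to _*ℤ_; -_ to -ℤ_)
open import Data.List using (List; []; _∷_; replicate; _++_)
open import Data.Fin using (Fin; zero; suc; toℕ; punchIn)
open import Data.Product using (Σ; _×_; ∃)
open import Relation.Binary.PropositionalEquality using (_≡_)
open import Relation.Nullary using (¬_)

-- The polynomial ring ℤ[q]: coefficient lists (constant term first),
-- with equality meaning equality of all coefficients (so trailing
-- zeros are irrelevant).

Poly : Set
Poly = List ℤ

coeff : Poly → ℕ → ℤ
coeff []       _       = 0ℤ
coeff (a ∷ p)  zero    = a
coeff (a ∷ p)  (suc k) = coeff p k

infix 4 _≈P_
_≈P_ : Poly → Poly → Set
p ≈P r = ∀ k → coeff p k ≡ coeff r k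

0P : Poly
0P = []

1P : Poly
1P = 1ℤ ∷ []

infixl 6 _+P_
_+P_ : Poly → Poly → Poly
[]      +P r       = r
(a ∷ p) +P []      = a ∷ p
(a ∷ p) +P (b ∷ r) = (a +ℤ b) ∷ (p +P r)

-P_ : Poly → Poly
-P []      = []
-P (a ∷ p) = (-ℤ a) ∷ (-P p)

scaleP : ℤ → Poly → Poly
scaleP c []      = []
scaleP c (a ∷ p) = (c *ℤ a) ∷ scaleP c p

infixl 7 _*P_
_*P_ : Poly → Poly → Poly
[]      *P r = []
(a ∷ p) *P r = scaleP a r +P (0ℤ ∷ (p *P r))

infix 4 _∣P_
_∣P_ : Poly → Poly → Set
d ∣P p = Σ Poly λ c → p ≈P c *P d

qPow : ℕ → Poly
qPow k = replicate k 0ℤ ++ (1ℤ ∷ [])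

qInt : ℕ → Poly
qInt k = replicate k 1ℤ

qFact : ℕ → Poly
qFact zero    = 1P
qFact (suc k) = qFact k *P qInt (suc k)

Mat : ℕ → ℕ → Set
Mat m n = Fin m → Fin n → Poly

sumP : ∀ {n} → (Fin n → Poly) → Poly
sumP {zero}  f = 0P
sumP {suc n} f = f zero +P sumP (λ i → f (suc i))

infixl 7 _⊗_
_⊗_ : ∀ {m n k} → Mat m n → Mat n k → Mat m k
(A ⊗ B) i j = sumP (λ l → A i l *P B l j)

signP : ℕ → Poly → Poly
signP zero    p = p
signP (suc k) p = -P (signP k p)

det : ∀ {n} → Mat n n → Poly
det {zero}  A = 1P
det {suc n} A =
  sumP (λ j → signP (toℕ j) (A zero j *P det (λ r c → A (suc r) (punchIn j c))))

InSL : ∀ {n} → Mat n n → Set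
InSL P = det P ≈P 1P

infix 4 _≈M_
_≈M_ : ∀ {m n} → Mat m n → Mat m n → Set
A ≈M B = ∀ i j → A i j ≈P B i j

IsDiagDivChain : ∀ {m n} → Mat m n → Set
IsDiagDivChain {m} {n} D =
  (∀ (i : Fin m) (j : Fin n) → ¬ (toℕ i ≡ toℕ j) → D i j ≈P 0P) ×
  (∀ (i j : Fin m) (i' j' : Fin n) → toℕ i ≡ toℕ i' → toℕ j ≡ toℕ j' →
     toℕ j ≤ toℕ i → D j j' ∣P D i i')

IsSSNF : ∀ {m n} → Mat m n → Mat m n → Set
IsSSNF {m} {n} A D =
  Σ (Mat m m) λ P → Σ (Mat n n) λ Q →
    InSL P × InSL Q × ((P ⊗ A) ⊗ Q ≈M D) × IsDiagDivChain D

factMat : (n : ℕ) → Mat (suc n) (suc n)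
factMat n i j = qFact (toℕ i +ℕ toℕ j)

diagEntry : ℕ → Poly
diagEntry k = qPow (k *ℕ k) *P (qFact k *P qFact k)

diagMat : (n : ℕ) → Mat (suc n) (suc n)
diagMat n i j with toℕ i Data.Nat.≟ toℕ j
... | Relation.Nullary.yes _ = diagEntry (toℕ i)
... | Relation.Nullary.no  _ = 0P

-- Write G_k for the matrix with entries
--   q^{k²} · q^{kx}[x+1]_q⋯[x+k]_q · q^{ky}[y+1]_q⋯[y+k]_q · [x+y]!_q ,
-- so that G_0 = ([x+y]!_q). Subtracting q^k[x+k+1]_q times row x from row x+1, for all x at
-- once, and then doing the same with the columns, turns G_k into diag(q^{k²}[k]!_q², G_{k+1}).
-- This rests on two identities: q^{k(x+1)}[x+2]_q⋯[x+k+1]_q · [x+1]_q equals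
-- q^k[x+k+1]_q · q^{kx}[x+1]_q⋯[x+k]_q, and [x+y+1]_q = [x+1]_q + q^{x+1}[y]_q.
-- The row and column operations are unitriangular, so have determinant 1, and induction on the
-- size gives P ([i+j]!_q) Q = diag(q^{k²}[k]!_q²)_k. The divisibility chain holds because
-- q^{(j+t)²}[j+t]!_q² = q^{j²}[j]!_q² · q^{2jt+t²}([j+1]_q⋯[j+t]_q)².

module Submission where

open import Defs
open import Algebra.Bundles using (CommutativeRing)
open import Data.Empty using (⊥-elim)
open import Data.Fin using (Fin; zero; suc; toℕ; inject₁; punchIn)
open import Data.Fin.Properties using (toℕ-inject₁)
open import Data.Integer using (0ℤ; 1ℤ) renaming (_+_ to _+ℤ_; _*_ to _*ℤ_; -_ to -ℤ_)
import Data.Integer.Properties as ℤ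
open import Data.List using ([]; _∷_)
open import Data.Maybe using (Maybe; just; nothing)
open import Data.Nat using (ℕ; zero; suc; _+_; _*_; _≤_; _≟_)
import Data.Nat.Properties as ℕ
import Data.Nat.Tactic.RingSolver as ℕ-Solver
open import Data.Product using (_×_; _,_)
open import Data.Unit using (⊤; tt)
open import Function using (_∘_)
open import Level using (0ℓ)
open import Relation.Binary.Bundles using (Setoid)
open import Relation.Binary.PropositionalEquality
  using (_≡_; refl; sym; trans; cong; cong₂; module ≡-Reasoning)
open import Relation.Binary.Structures using (IsEquivalence)
import Relation.Binary.Reasoning.Setoid as SetoidReasoning
open import Relation.Nullary using (yes; no; ¬_)
open import Tactic.RingSolver using (solve-∀)
open import Tactic.RingSolver.Core.AlmostCommutativeRing
  using (AlmostCommutativeRing; fromCommutativeRing)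

-- The record makes both polynomials inferable from a proof, which _≈P_ alone does not.
infix 4 _≈_
record _≈_ (p r : Poly) : Set where
  constructor mk≈
  field coeff-≡ : p ≈P r
open _≈_ public

≈-refl : ∀ {p} → p ≈ p
≈-refl = mk≈ λ _ → refl

≈-sym : ∀ {p r} → p ≈ r → r ≈ p
≈-sym (mk≈ e) = mk≈ λ k → sym (e k)

≈-trans : ∀ {p r s} → p ≈ r → r ≈ s → p ≈ s
≈-trans (mk≈ e) (mk≈ f) = mk≈ λ k → trans (e k) (f k)

≈-reflexive : ∀ {p r} → p ≡ r → p ≈ r
≈-reflexive refl = ≈-refl

≈-isEquivalence : IsEquivalence _≈_
≈-isEquivalence = record { refl = ≈-refl ; sym = ≈-sym ; trans = ≈-trans }

≈-setoid : Setoid 0ℓ 0ℓ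
≈-setoid = record { isEquivalence = ≈-isEquivalence }

module ≈-Reasoning = SetoidReasoning ≈-setoid

∷-cong : ∀ {a b p r} → a ≡ b → p ≈ r → (a ∷ p) ≈ (b ∷ r)
∷-cong a≡b (mk≈ p≈r) = mk≈ λ { zero → a≡b ; (suc k) → p≈r k }

0∷0P≈0P : (0ℤ ∷ 0P) ≈ 0P
0∷0P≈0P = mk≈ λ { zero → refl ; (suc k) → refl }

coeff-+P : ∀ p r k → coeff (p +P r) k ≡ coeff p k +ℤ coeff r k
coeff-+P []      r       k       = sym (ℤ.+-identityˡ _)
coeff-+P (a ∷ p) []      k       = sym (ℤ.+-identityʳ _)
coeff-+P (a ∷ p) (b ∷ r) zero    = refl
coeff-+P (a ∷ p) (b ∷ r) (suc k) = coeff-+P p r k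

coeff--P : ∀ p k → coeff (-P p) k ≡ -ℤ coeff p k
coeff--P []      k       = refl
coeff--P (a ∷ p) zero    = refl
coeff--P (a ∷ p) (suc k) = coeff--P p k

coeff-scaleP : ∀ c p k → coeff (scaleP c p) k ≡ c *ℤ coeff p k
coeff-scaleP c []      k       = sym (ℤ.*-zeroʳ c)
coeff-scaleP c (a ∷ p) zero    = refl
coeff-scaleP c (a ∷ p) (suc k) = coeff-scaleP c p k

+P-cong : ∀ {p p' r r'} → p ≈ p' → r ≈ r' → p +P r ≈ p' +P r'
+P-cong {p} {p'} {r} {r'} (mk≈ e) (mk≈ f) = mk≈ λ k →
  trans (coeff-+P p r k) (trans (cong₂ _+ℤ_ (e k) (f k)) (sym (coeff-+P p' r' k)))

+P-congˡ : ∀ p {r r'} → r ≈ r' → p +P r ≈ p +P r'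
+P-congˡ p = +P-cong (≈-refl {p})

+P-congʳ : ∀ r {p p'} → p ≈ p' → p +P r ≈ p' +P r
+P-congʳ r e = +P-cong e (≈-refl {r})

+P-assoc : ∀ p r s → (p +P r) +P s ≈ p +P (r +P s)
+P-assoc p r s = mk≈ λ k → begin
  coeff ((p +P r) +P s) k
    ≡⟨ trans (coeff-+P (p +P r) s k) (cong (_+ℤ coeff s k) (coeff-+P p r k)) ⟩
  (coeff p k +ℤ coeff r k) +ℤ coeff s k
    ≡⟨ ℤ.+-assoc (coeff p k) _ _ ⟩
  coeff p k +ℤ (coeff r k +ℤ coeff s k)
    ≡⟨ trans (coeff-+P p (r +P s) k) (cong (coeff p k +ℤ_) (coeff-+P r s k)) ⟨
  coeff (p +P (r +P s)) k  ∎
  where open ≡-Reasoning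

+P-comm : ∀ p r → p +P r ≈ r +P p
+P-comm p r = mk≈ λ k →
  trans (coeff-+P p r k) (trans (ℤ.+-comm (coeff p k) _) (sym (coeff-+P r p k)))

+P-identityʳ : ∀ p → p +P 0P ≈ p
+P-identityʳ p = mk≈ λ k → trans (coeff-+P p [] k) (ℤ.+-identityʳ _)

-P-inverseˡ : ∀ p → (-P p) +P p ≈ 0P
-P-inverseˡ p = mk≈ λ k →
  trans (coeff-+P (-P p) p k) (trans (cong (_+ℤ coeff p k) (coeff--P p k)) (ℤ.+-inverseˡ (coeff p k)))

-P-inverseʳ : ∀ p → p +P (-P p) ≈ 0P
-P-inverseʳ p = mk≈ λ k →
  trans (coeff-+P p (-P p) k) (trans (cong (coeff p k +ℤ_) (coeff--P p k)) (ℤ.+-inverseʳ (coeff p k)))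

-P-cong : ∀ {p r} → p ≈ r → -P p ≈ -P r
-P-cong {p} {r} (mk≈ e) = mk≈ λ k →
  trans (coeff--P p k) (trans (cong -ℤ_ (e k)) (sym (coeff--P r k)))

+P-interchange : ∀ a b c d → (a +P b) +P (c +P d) ≈ (a +P c) +P (b +P d)
+P-interchange a b c d = begin
  (a +P b) +P (c +P d)  ≈⟨ +P-assoc a b (c +P d) ⟩
  a +P (b +P (c +P d))  ≈⟨ +P-congˡ a (+P-assoc b c d) ⟨
  a +P ((b +P c) +P d)  ≈⟨ +P-congˡ a (+P-congʳ d (+P-comm b c)) ⟩
  a +P ((c +P b) +P d)  ≈⟨ +P-congˡ a (+P-assoc c b d) ⟩
  a +P (c +P (b +P d))  ≈⟨ +P-assoc a c (b +P d) ⟨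
  (a +P c) +P (b +P d)  ∎
  where open ≈-Reasoning

scaleP-cong : ∀ c {p r} → p ≈ r → scaleP c p ≈ scaleP c r
scaleP-cong c {p} {r} (mk≈ e) = mk≈ λ k →
  trans (coeff-scaleP c p k) (trans (cong (c *ℤ_) (e k)) (sym (coeff-scaleP c r k)))

scaleP-distribˡ : ∀ c p r → scaleP c (p +P r) ≈ scaleP c p +P scaleP c r
scaleP-distribˡ c p r = mk≈ λ k → begin
  coeff (scaleP c (p +P r)) k
    ≡⟨ trans (coeff-scaleP c (p +P r) k) (cong (c *ℤ_) (coeff-+P p r k)) ⟩
  c *ℤ (coeff p k +ℤ coeff r k)                 ≡⟨ ℤ.*-distribˡ-+ c _ _ ⟩
  c *ℤ coeff p k +ℤ c *ℤ coeff r k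
    ≡⟨ cong₂ _+ℤ_ (coeff-scaleP c p k) (coeff-scaleP c r k) ⟨
  coeff (scaleP c p) k +ℤ coeff (scaleP c r) k  ≡⟨ coeff-+P (scaleP c p) (scaleP c r) k ⟨
  coeff (scaleP c p +P scaleP c r) k            ∎
  where open ≡-Reasoning

scaleP-distribʳ : ∀ a b p → scaleP (a +ℤ b) p ≈ scaleP a p +P scaleP b p
scaleP-distribʳ a b p = mk≈ λ k → begin
  coeff (scaleP (a +ℤ b) p) k                   ≡⟨ coeff-scaleP (a +ℤ b) p k ⟩
  (a +ℤ b) *ℤ coeff p k                         ≡⟨ ℤ.*-distribʳ-+ (coeff p k) a b ⟩
  a *ℤ coeff p k +ℤ b *ℤ coeff p k
    ≡⟨ cong₂ _+ℤ_ (coeff-scaleP a p k) (coeff-scaleP b p k) ⟨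
  coeff (scaleP a p) k +ℤ coeff (scaleP b p) k  ≡⟨ coeff-+P (scaleP a p) (scaleP b p) k ⟨
  coeff (scaleP a p +P scaleP b p) k            ∎
  where open ≡-Reasoning

scaleP-assoc : ∀ a b p → scaleP a (scaleP b p) ≈ scaleP (a *ℤ b) p
scaleP-assoc a b p = mk≈ λ k →
  trans (coeff-scaleP a (scaleP b p) k) (trans (cong (a *ℤ_) (coeff-scaleP b p k))
    (trans (sym (ℤ.*-assoc a b (coeff p k))) (sym (coeff-scaleP (a *ℤ b) p k))))

scaleP-zero : ∀ p → scaleP 0ℤ p ≈ 0P
scaleP-zero p = mk≈ λ k → coeff-scaleP 0ℤ p k

scaleP-one : ∀ p → scaleP 1ℤ p ≈ p
scaleP-one p = mk≈ λ k → trans (coeff-scaleP 1ℤ p k) (ℤ.*-identityˡ _)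

*P-zeroʳ : ∀ p → p *P 0P ≈ 0P
*P-zeroʳ []      = ≈-refl
*P-zeroʳ (a ∷ p) = ≈-trans (∷-cong refl (*P-zeroʳ p)) 0∷0P≈0P

*P-congˡ : ∀ p {r r'} → r ≈ r' → p *P r ≈ p *P r'
*P-congˡ []      e = ≈-refl
*P-congˡ (a ∷ p) e = +P-cong (scaleP-cong a e) (∷-cong refl (*P-congˡ p e))

*P-distribʳ : ∀ r p p' → (p +P p') *P r ≈ p *P r +P p' *P r
*P-distribʳ r []      p'       = ≈-refl
*P-distribʳ r (a ∷ p) []       = ≈-sym (+P-identityʳ _)
*P-distribʳ r (a ∷ p) (b ∷ p') =
  ≈-trans (+P-cong (scaleP-distribʳ a b r) (∷-cong refl (*P-distribʳ r p p')))
          (+P-interchange (scaleP a r) (scaleP b r) (0ℤ ∷ p *P r) (0ℤ ∷ p' *P r))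

*P-distribˡ : ∀ p r r' → p *P (r +P r') ≈ p *P r +P p *P r'
*P-distribˡ []      r r' = ≈-refl
*P-distribˡ (a ∷ p) r r' =
  ≈-trans (+P-cong (scaleP-distribˡ a r r') (∷-cong refl (*P-distribˡ p r r')))
          (+P-interchange (scaleP a r) (scaleP a r') (0ℤ ∷ p *P r) (0ℤ ∷ p *P r'))

scaleP-*P : ∀ a r s → scaleP a r *P s ≈ scaleP a (r *P s)
scaleP-*P a []      s = ≈-refl
scaleP-*P a (b ∷ r) s =
  ≈-trans (+P-cong (≈-sym (scaleP-assoc a b s)) (∷-cong (sym (ℤ.*-zeroʳ a)) (scaleP-*P a r s)))
          (≈-sym (scaleP-distribˡ a (scaleP b s) (0ℤ ∷ r *P s)))

0∷-*P : ∀ p r → (0ℤ ∷ p) *P r ≈ 0ℤ ∷ p *P r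
0∷-*P p r = +P-cong (scaleP-zero r) ≈-refl

*P-assoc : ∀ p r s → (p *P r) *P s ≈ p *P (r *P s)
*P-assoc []      r s = ≈-refl
*P-assoc (a ∷ p) r s =
  ≈-trans (*P-distribʳ s (scaleP a r) (0ℤ ∷ p *P r))
          (+P-cong (scaleP-*P a r s) (≈-trans (0∷-*P (p *P r) s) (∷-cong refl (*P-assoc p r s))))

*P-∷ʳ : ∀ p b r → p *P (b ∷ r) ≈ scaleP b p +P (0ℤ ∷ p *P r)
*P-∷ʳ []      b r = ≈-sym 0∷0P≈0P
*P-∷ʳ (a ∷ p) b r = ∷-cong (cong (_+ℤ 0ℤ) (ℤ.*-comm a b)) (begin
  scaleP a r +P p *P (b ∷ r)                       ≈⟨ +P-cong ≈-refl (*P-∷ʳ p b r) ⟩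
  scaleP a r +P (scaleP b p +P (0ℤ ∷ p *P r))      ≈⟨ +P-assoc (scaleP a r) (scaleP b p) _ ⟨
  (scaleP a r +P scaleP b p) +P (0ℤ ∷ p *P r)      ≈⟨ +P-congʳ _ (+P-comm (scaleP a r) _) ⟩
  (scaleP b p +P scaleP a r) +P (0ℤ ∷ p *P r)      ≈⟨ +P-assoc (scaleP b p) (scaleP a r) _ ⟩
  scaleP b p +P (scaleP a r +P (0ℤ ∷ p *P r))      ∎)
  where open ≈-Reasoning

*P-comm : ∀ p r → p *P r ≈ r *P p
*P-comm []      r = ≈-sym (*P-zeroʳ r)
*P-comm (a ∷ p) r = ≈-trans (+P-cong ≈-refl (∷-cong refl (*P-comm p r))) (≈-sym (*P-∷ʳ r a p))

*P-congʳ : ∀ r {p p'} → p ≈ p' → p *P r ≈ p' *P r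
*P-congʳ r {p} {p'} e = ≈-trans (*P-comm p r) (≈-trans (*P-congˡ r e) (*P-comm r p'))

*P-cong : ∀ {p p' r r'} → p ≈ p' → r ≈ r' → p *P r ≈ p' *P r'
*P-cong {p' = p'} {r = r} e f = ≈-trans (*P-congʳ r e) (*P-congˡ p' f)

*P-identityˡ : ∀ p → 1P *P p ≈ p
*P-identityˡ p = ≈-trans (+P-cong (scaleP-one p) 0∷0P≈0P) (+P-identityʳ p)

*P-identityʳ : ∀ p → p *P 1P ≈ p
*P-identityʳ p = ≈-trans (*P-comm p 1P) (*P-identityˡ p)

ℤ[q] : CommutativeRing 0ℓ 0ℓ
ℤ[q] = record
  { Carrier = Poly ; _≈_ = _≈_ ; _+_ = _+P_ ; _*_ = _*P_ ; -_ = -P_ ; 0# = 0P ; 1# = 1P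
  ; isCommutativeRing = record
    { isRing = record
      { +-isAbelianGroup = record
        { isGroup = record
          { isMonoid = record
            { isSemigroup = record
              { isMagma = record { isEquivalence = ≈-isEquivalence ; ∙-cong = +P-cong }
              ; assoc = +P-assoc }
            ; identity = (λ _ → ≈-refl) , +P-identityʳ }
          ; inverse = -P-inverseˡ , -P-inverseʳ
          ; ⁻¹-cong = -P-cong }
        ; comm = +P-comm }
      ; *-cong = *P-cong
      ; *-assoc = *P-assoc
      ; *-identity = *P-identityˡ , *P-identityʳ
      ; distrib = *P-distribˡ , *P-distribʳ }
    ; *-comm = *P-comm } }

0≈? : (p : Poly) → Maybe (0P ≈ p)
0≈? []      = just ≈-refl
0≈? (a ∷ p) with a ℤ.≟ 0ℤ | 0≈? p
... | yes a≡0 | just 0≈p = just (≈-trans (≈-sym 0∷0P≈0P) (∷-cong (sym a≡0) 0≈p))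
... | _       | _        = nothing

ℤ[q]-solver : AlmostCommutativeRing 0ℓ 0ℓ
ℤ[q]-solver = fromCommutativeRing ℤ[q] 0≈?

c*[a-b]+r≈r : ∀ {a b} c r → a ≈ b → c *P (a +P -P b) +P r ≈ r
c*[a-b]+r≈r {a} {b} c r a≈b = +P-congʳ r (≈-trans (*P-congˡ c a-b≈0) (*P-zeroʳ c))
  where
  a-b≈0 : a +P -P b ≈ 0P
  a-b≈0 = ≈-trans (+P-congʳ (-P b) a≈b) (-P-inverseʳ b)

q : Poly
q = qPow 1

0∷≈q*P : ∀ p → (0ℤ ∷ p) ≈ q *P p
0∷≈q*P p = ≈-sym (≈-trans (0∷-*P 1P p) (∷-cong refl (*P-identityˡ p)))

qPow-+ : ∀ a b → qPow (a + b) ≈ qPow a *P qPow b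
qPow-+ zero    b = ≈-sym (*P-identityˡ (qPow b))
qPow-+ (suc a) b = ≈-trans (∷-cong refl (qPow-+ a b)) (≈-sym (0∷-*P (qPow a) (qPow b)))

qInt-+ : ∀ a b → qInt (a + b) ≈ qInt a +P qPow a *P qInt b
qInt-+ zero    b = ≈-sym (*P-identityˡ (qInt b))
qInt-+ (suc a) b =
  ≈-trans (∷-cong refl (qInt-+ a b)) (≈-sym (+P-congˡ (1ℤ ∷ qInt a) (0∷-*P (qPow a) (qInt b))))

qRising : ℕ → ℕ → Poly
qRising zero    x = 1P
qRising (suc m) x = qRising m x *P qInt (x + suc m)

qFact-+ : ∀ k t → qFact (k + t) ≈ qFact k *P qRising t k
qFact-+ k zero    =
  ≈-trans (≈-reflexive (cong qFact (ℕ.+-identityʳ k))) (≈-sym (*P-identityʳ (qFact k)))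
qFact-+ k (suc t) = begin
  qFact (k + suc t)                               ≡⟨ cong qFact (ℕ.+-suc k t) ⟩
  qFact (k + t) *P qInt (suc (k + t))             ≈⟨ *P-congʳ (qInt (suc (k + t))) (qFact-+ k t) ⟩
  (qFact k *P qRising t k) *P qInt (suc (k + t))  ≈⟨ *P-assoc (qFact k) (qRising t k) _ ⟩
  qFact k *P (qRising t k *P qInt (suc (k + t)))
    ≡⟨ cong (λ u → qFact k *P (qRising t k *P qInt u)) (ℕ.+-suc k t) ⟨
  qFact k *P qRising (suc t) k                    ∎
  where open ≈-Reasoning

qFact≈qRising : ∀ k → qFact k ≈ qRising k 0
qFact≈qRising k = ≈-trans (qFact-+ 0 k) (*P-identityˡ (qRising k 0))

qRising-suc : ∀ m x → qRising m (suc x) *P qInt (suc x) ≈ qRising m x *P qInt (x + suc m)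
qRising-suc zero    x = *P-congˡ 1P (≈-reflexive (cong qInt (ℕ.+-comm 1 x)))
qRising-suc (suc m) x = begin
  (qRising m (suc x) *P qInt (suc x + suc m)) *P qInt (suc x)
    ≈⟨ swap (qRising m (suc x)) _ _ ⟩
  (qRising m (suc x) *P qInt (suc x)) *P qInt (suc x + suc m)
    ≈⟨ *P-congʳ (qInt (suc x + suc m)) (qRising-suc m x) ⟩
  (qRising m x *P qInt (x + suc m)) *P qInt (suc x + suc m)
    ≡⟨ cong (λ u → (qRising m x *P qInt (x + suc m)) *P qInt u) (ℕ.+-suc x (suc m)) ⟨
  qRising (suc m) x *P qInt (x + suc (suc m))  ∎
  where
  open ≈-Reasoning
  swap : ∀ a b c → (a *P b) *P c ≈ (a *P c) *P b
  swap = solve-∀ ℤ[q]-solver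

qPow-square-suc : ∀ k → qPow (suc k * suc k) ≈ qPow (k * k) *P (qPow k *P qPow k *P q)
qPow-square-suc k = begin
  qPow (suc k * suc k)                            ≡⟨ cong qPow (square-suc k) ⟩
  qPow (k * k + (k + (k + 1)))                    ≈⟨ qPow-+ (k * k) _ ⟩
  qPow (k * k) *P qPow (k + (k + 1))
    ≈⟨ *P-congˡ (qPow (k * k)) (≈-trans (qPow-+ k (k + 1)) (*P-congˡ (qPow k) (qPow-+ k 1))) ⟩
  qPow (k * k) *P (qPow k *P (qPow k *P q))
    ≈⟨ *P-congˡ (qPow (k * k)) (≈-sym (*P-assoc (qPow k) (qPow k) q)) ⟩
  qPow (k * k) *P (qPow k *P qPow k *P q)         ∎
  where
  open ≈-Reasoning
  square-suc : ∀ k → suc k * suc k ≡ k * k + (k + (k + 1))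
  square-suc = ℕ-Solver.solve-∀

weight : ℕ → ℕ → Poly
weight k x = qPow (k * x) *P qRising k x

multiplier : ℕ → ℕ → Poly
multiplier k x = qPow k *P qInt (x + suc k)

-- The matrix G_k; its corner entry q^{k²}[k]!_q² is the k-th diagonal entry.
schur : ℕ → ℕ → ℕ → Poly
schur k x y = qPow (k * k) *P weight k x *P weight k y *P qFact (x + y)

weight-suc : ∀ k x → weight k (suc x) *P qInt (suc x) ≈ multiplier k x *P weight k x
weight-suc k x = begin
  (qPow (k * suc x) *P qRising k (suc x)) *P qInt (suc x)
    ≈⟨ *P-congʳ (qInt (suc x)) (*P-congʳ (qRising k (suc x)) qPow-k*suc-x) ⟩
  ((qPow k *P qPow (k * x)) *P qRising k (suc x)) *P qInt (suc x)
    ≈⟨ reassoc (qPow k) (qPow (k * x)) _ _ ⟩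
  qPow k *P (qPow (k * x) *P (qRising k (suc x) *P qInt (suc x)))
    ≈⟨ *P-congˡ (qPow k) (*P-congˡ (qPow (k * x)) (qRising-suc k x)) ⟩
  qPow k *P (qPow (k * x) *P (qRising k x *P qInt (x + suc k)))
    ≈⟨ regroup (qPow k) (qPow (k * x)) (qRising k x) _ ⟩
  multiplier k x *P weight k x  ∎
  where
  open ≈-Reasoning
  qPow-k*suc-x : qPow (k * suc x) ≈ qPow k *P qPow (k * x)
  qPow-k*suc-x = ≈-trans (≈-reflexive (cong qPow (ℕ.*-suc k x))) (qPow-+ k (k * x))
  reassoc : ∀ a b c d → ((a *P b) *P c) *P d ≈ a *P (b *P (c *P d))
  reassoc = solve-∀ ℤ[q]-solver
  regroup : ∀ a b c d → a *P (b *P (c *P d)) ≈ (a *P d) *P (b *P c)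
  regroup = solve-∀ ℤ[q]-solver

multiplier-weight : ∀ k x → multiplier k x *P weight k x *P qPow x ≈ qPow k *P weight (suc k) x
multiplier-weight k x = begin
  (qPow k *P qInt (x + suc k)) *P (qPow (k * x) *P qRising k x) *P qPow x
    ≈⟨ regroup (qPow k) _ _ _ _ ⟩
  qPow k *P ((qPow x *P qPow (k * x)) *P (qRising k x *P qInt (x + suc k)))
    ≈⟨ *P-congˡ (qPow k) (*P-congʳ _ (qPow-+ x (k * x))) ⟨
  qPow k *P weight (suc k) x  ∎
  where
  open ≈-Reasoning
  regroup : ∀ a b c d e → ((a *P b) *P (c *P d)) *P e ≈ a *P ((e *P c) *P (d *P b))
  regroup = solve-∀ ℤ[q]-solver

schur-sym : ∀ k x y → schur k x y ≈ schur k y x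
schur-sym k x y =
  ≈-trans (swap (qPow (k * k)) (weight k x) (weight k y) (qFact (x + y)))
          (*P-congˡ (qPow (k * k) *P weight k y *P weight k x) (≈-reflexive (cong qFact (ℕ.+-comm x y))))
  where
  swap : ∀ s a b f → ((s *P a) *P b) *P f ≈ ((s *P b) *P a) *P f
  swap = solve-∀ ℤ[q]-solver

rowDifference : ℕ → ℕ → ℕ → Poly
rowDifference k x y = schur k (suc x) y +P -P (multiplier k x *P schur k x y)

rowDifference-≈ : ∀ k x y → rowDifference k x y ≈
  qPow (k * k) *P weight k y *P qFact (x + y) *P weight k (suc x) *P qPow (suc x) *P qInt y
rowDifference-≈ k x y = begin
  s *P X₁ *P Xy *P (F *P qInt (suc x + y)) +P -P (c *P (s *P Xx *P Xy *P F))
    ≈⟨ +P-congʳ _ (*P-congˡ (s *P X₁ *P Xy) (*P-congˡ F (qInt-+ (suc x) y))) ⟩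
  s *P X₁ *P Xy *P (F *P (I₁ +P Q₁ *P Iy)) +P -P (c *P (s *P Xx *P Xy *P F))
    ≈⟨ regroup s X₁ Xy F I₁ Q₁ Iy c Xx ⟩
  s *P Xy *P F *P (X₁ *P I₁ +P -P (c *P Xx)) +P s *P Xy *P F *P X₁ *P Q₁ *P Iy
    ≈⟨ c*[a-b]+r≈r (s *P Xy *P F) _ (weight-suc k x) ⟩
  s *P Xy *P F *P X₁ *P Q₁ *P Iy  ∎
  where
  open ≈-Reasoning
  s X₁ Xx Xy F c I₁ Q₁ Iy : Poly
  s = qPow (k * k)
  X₁ = weight k (suc x)
  Xx = weight k x
  Xy = weight k y
  F = qFact (x + y)
  c = multiplier k x
  I₁ = qInt (suc x)
  Q₁ = qPow (suc x)
  Iy = qInt y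
  regroup : ∀ s X₁ Xy F I₁ Q₁ Iy c Xx →
    s *P X₁ *P Xy *P (F *P (I₁ +P Q₁ *P Iy)) +P -P (c *P (s *P Xx *P Xy *P F)) ≈
    s *P Xy *P F *P (X₁ *P I₁ +P -P (c *P Xx)) +P s *P Xy *P F *P X₁ *P Q₁ *P Iy
  regroup = solve-∀ ℤ[q]-solver

rowDifference-zero : ∀ k x → rowDifference k x 0 ≈ 0P
rowDifference-zero k x =
  ≈-trans (rowDifference-≈ k x 0)
          (*P-zeroʳ (qPow (k * k) *P weight k 0 *P qFact (x + 0) *P weight k (suc x) *P qPow (suc x)))

columnDifference-zero : ∀ k y → schur k 0 (suc y) +P -P (multiplier k y *P schur k 0 y) ≈ 0P
columnDifference-zero k y =
  ≈-trans (+P-cong (schur-sym k 0 (suc y)) (-P-cong (*P-congˡ (multiplier k y) (schur-sym k 0 y))))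
          (rowDifference-zero k y)

qFact-+-suc : ∀ x y → qFact (x + suc y) ≈ qFact (x + y) *P (qInt y +P qPow y *P qInt (suc x))
qFact-+-suc x y = begin
  qFact (x + suc y)                    ≡⟨ cong qFact (ℕ.+-suc x y) ⟩
  qFact (x + y) *P qInt (suc (x + y))  ≡⟨ cong (λ n → qFact (x + y) *P qInt n) suc-x+y≡y+suc-x ⟩
  qFact (x + y) *P qInt (y + suc x)    ≈⟨ *P-congˡ (qFact (x + y)) (qInt-+ y (suc x)) ⟩
  qFact (x + y) *P (qInt y +P qPow y *P qInt (suc x))  ∎
  where
  open ≈-Reasoning
  suc-x+y≡y+suc-x : suc (x + y) ≡ y + suc x
  suc-x+y≡y+suc-x = trans (cong suc (ℕ.+-comm x y)) (sym (ℕ.+-suc y x))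

schur-suc : ∀ k x y →
  qPow (k * k) *P qPow (suc x) *P qFact (x + y) *P (multiplier k x *P weight k x)
    *P (multiplier k y *P weight k y *P qPow y)
  ≈ schur (suc k) x y
schur-suc k x y = begin
  s *P qPow (suc x) *P F *P (cx *P Xx) *P (cy *P Xy *P Qy)
    ≈⟨ *P-congʳ (cy *P Xy *P Qy) (*P-congʳ (cx *P Xx) (*P-congʳ F (*P-congˡ s (0∷≈q*P Qx)))) ⟩
  s *P (q *P Qx) *P F *P (cx *P Xx) *P (cy *P Xy *P Qy)
    ≈⟨ regroup s q Qx F (cx *P Xx) (cy *P Xy *P Qy) ⟩
  s *P q *P (cx *P Xx *P Qx) *P (cy *P Xy *P Qy) *P F
    ≈⟨ *P-congʳ F (*P-cong (*P-congˡ (s *P q) (multiplier-weight k x)) (multiplier-weight k y)) ⟩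
  s *P q *P (qPow k *P weight (suc k) x) *P (qPow k *P weight (suc k) y) *P F
    ≈⟨ collect s q (qPow k) (weight (suc k) x) (weight (suc k) y) F ⟩
  s *P (qPow k *P qPow k *P q) *P weight (suc k) x *P weight (suc k) y *P F
    ≈⟨ *P-congʳ F (*P-congʳ (weight (suc k) y)
                    (*P-congʳ (weight (suc k) x) (qPow-square-suc k))) ⟨
  schur (suc k) x y  ∎
  where
  open ≈-Reasoning
  s F cx cy Xx Xy Qx Qy : Poly
  s = qPow (k * k)
  F = qFact (x + y)
  cx = multiplier k x
  cy = multiplier k y
  Xx = weight k x
  Xy = weight k y
  Qx = qPow x
  Qy = qPow y
  regroup : ∀ s q Qx F A B → s *P (q *P Qx) *P F *P A *P B ≈ s *P q *P (A *P Qx) *P B *P F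
  regroup = solve-∀ ℤ[q]-solver
  collect : ∀ s q a X Y F → s *P q *P (a *P X) *P (a *P Y) *P F ≈ s *P (a *P a *P q) *P X *P Y *P F
  collect = solve-∀ ℤ[q]-solver

doubleDifference-≈ : ∀ k x y →
  rowDifference k x (suc y) +P -P (multiplier k y *P rowDifference k x y) ≈ schur (suc k) x y
doubleDifference-≈ k x y = begin
  rowDifference k x (suc y) +P -P (cy *P rowDifference k x y)
    ≈⟨ +P-cong (rowDifference-≈ k x (suc y)) (-P-cong (*P-congˡ cy (rowDifference-≈ k x y))) ⟩
  s *P Xy₁ *P qFact (x + suc y) *P X₁ *P Q₁ *P Iy₁ +P -P (cy *P (s *P Xy *P F *P X₁ *P Q₁ *P Iy))
    ≈⟨ +P-congʳ _ (*P-congʳ Iy₁ (*P-congʳ Q₁ (*P-congʳ X₁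
                    (*P-congˡ (s *P Xy₁) (qFact-+-suc x y))))) ⟩
  s *P Xy₁ *P (F *P (Iy +P Qy *P I₁)) *P X₁ *P Q₁ *P Iy₁
    +P -P (cy *P (s *P Xy *P F *P X₁ *P Q₁ *P Iy))
    ≈⟨ regroup s Xy₁ F Iy Qy I₁ X₁ Q₁ Iy₁ cy Xy ⟩
  s *P X₁ *P Q₁ *P F *P Iy *P (Xy₁ *P Iy₁ +P -P (cy *P Xy))
    +P s *P Q₁ *P F *P (X₁ *P I₁) *P (Xy₁ *P Iy₁ *P Qy)
    ≈⟨ c*[a-b]+r≈r (s *P X₁ *P Q₁ *P F *P Iy) _ (weight-suc k y) ⟩
  s *P Q₁ *P F *P (X₁ *P I₁) *P (Xy₁ *P Iy₁ *P Qy)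
    ≈⟨ *P-cong (*P-congˡ (s *P Q₁ *P F) (weight-suc k x)) (*P-congʳ Qy (weight-suc k y)) ⟩
  s *P Q₁ *P F *P (multiplier k x *P weight k x) *P (cy *P Xy *P Qy)
    ≈⟨ schur-suc k x y ⟩
  schur (suc k) x y  ∎
  where
  open ≈-Reasoning
  s F cy X₁ Xy Xy₁ I₁ Iy Iy₁ Q₁ Qy : Poly
  s = qPow (k * k)
  F = qFact (x + y)
  cy = multiplier k y
  X₁ = weight k (suc x)
  Xy = weight k y
  Xy₁ = weight k (suc y)
  I₁ = qInt (suc x)
  Iy = qInt y
  Iy₁ = qInt (suc y)
  Q₁ = qPow (suc x)
  Qy = qPow y
  regroup : ∀ s Xy₁ F Iy Qy I₁ X₁ Q₁ Iy₁ cy Xy →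
    s *P Xy₁ *P (F *P (Iy +P Qy *P I₁)) *P X₁ *P Q₁ *P Iy₁
      +P -P (cy *P (s *P Xy *P F *P X₁ *P Q₁ *P Iy))
    ≈ s *P X₁ *P Q₁ *P F *P Iy *P (Xy₁ *P Iy₁ +P -P (cy *P Xy))
      +P s *P Q₁ *P F *P (X₁ *P I₁) *P (Xy₁ *P Iy₁ *P Qy)
  regroup = solve-∀ ℤ[q]-solver

infix 4 _≈ᴹ_
_≈ᴹ_ : ∀ {m n} → Mat m n → Mat m n → Set
A ≈ᴹ B = ∀ i j → A i j ≈ B i j

≈ᴹ-setoid : ℕ → ℕ → Setoid 0ℓ 0ℓ
≈ᴹ-setoid m n = record
  { Carrier = Mat m n
  ; _≈_ = _≈ᴹ_
  ; isEquivalence = record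
    { refl = λ i j → ≈-refl
    ; sym = λ e i j → ≈-sym (e i j)
    ; trans = λ e f i j → ≈-trans (e i j) (f i j) } }

module ≈ᴹ-Reasoning {m n} = SetoidReasoning (≈ᴹ-setoid m n)

≈ᴹ-refl : ∀ {m n} {A : Mat m n} → A ≈ᴹ A
≈ᴹ-refl i j = ≈-refl

≈ᴹ-sym : ∀ {m n} {A B : Mat m n} → A ≈ᴹ B → B ≈ᴹ A
≈ᴹ-sym = Setoid.sym (≈ᴹ-setoid _ _)

≈ᴹ-trans : ∀ {m n} {A B C : Mat m n} → A ≈ᴹ B → B ≈ᴹ C → A ≈ᴹ C
≈ᴹ-trans = Setoid.trans (≈ᴹ-setoid _ _)

sumP-cong : ∀ {n} {f g : Fin n → Poly} → (∀ i → f i ≈ g i) → sumP f ≈ sumP g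
sumP-cong {zero}  e = ≈-refl
sumP-cong {suc n} e = +P-cong (e zero) (sumP-cong (e ∘ suc))

sumP-zero : ∀ {n} {f : Fin n → Poly} → (∀ i → f i ≈ 0P) → sumP f ≈ 0P
sumP-zero {zero}  e = ≈-refl
sumP-zero {suc n} e = +P-cong (e zero) (sumP-zero (e ∘ suc))

sumP-distrib-+P : ∀ {n} (f g : Fin n → Poly) → sumP (λ i → f i +P g i) ≈ sumP f +P sumP g
sumP-distrib-+P {zero}  f g = ≈-refl
sumP-distrib-+P {suc n} f g =
  ≈-trans (+P-congˡ (f zero +P g zero) (sumP-distrib-+P (f ∘ suc) (g ∘ suc)))
          (+P-interchange (f zero) (g zero) (sumP (f ∘ suc)) (sumP (g ∘ suc)))

*P-distribˡ-sumP : ∀ {n} c (f : Fin n → Poly) → c *P sumP f ≈ sumP (λ i → c *P f i)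
*P-distribˡ-sumP {zero}  c f = *P-zeroʳ c
*P-distribˡ-sumP {suc n} c f =
  ≈-trans (*P-distribˡ c (f zero) _) (+P-congˡ (c *P f zero) (*P-distribˡ-sumP c (f ∘ suc)))

*P-distribʳ-sumP : ∀ {n} c (f : Fin n → Poly) → sumP f *P c ≈ sumP (λ i → f i *P c)
*P-distribʳ-sumP c f =
  ≈-trans (*P-comm (sumP f) c) (≈-trans (*P-distribˡ-sumP c f) (sumP-cong λ i → *P-comm c (f i)))

sumP-comm : ∀ {m n} (f : Fin m → Fin n → Poly) →
  sumP (λ i → sumP (f i)) ≈ sumP (λ j → sumP (λ i → f i j))
sumP-comm {zero} {n} f = ≈-sym (sumP-zero {n} λ _ → ≈-refl)
sumP-comm {suc m} f = ≈-trans (+P-congˡ (sumP (f zero)) (sumP-comm (f ∘ suc)))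
                              (≈-sym (sumP-distrib-+P (f zero) (λ j → sumP (λ i → f (suc i) j))))

δ : ∀ {n} → Fin n → Fin n → Poly
δ zero    zero    = 1P
δ zero    (suc _) = 0P
δ (suc _) zero    = 0P
δ (suc i) (suc j) = δ i j

sumP-δ : ∀ {n} (i : Fin n) (f : Fin n → Poly) → sumP (λ l → δ i l *P f l) ≈ f i
sumP-δ {suc n} zero    f =
  ≈-trans (+P-cong (*P-identityˡ (f zero)) (sumP-zero {n} λ _ → ≈-refl)) (+P-identityʳ (f zero))
sumP-δ {suc n} (suc i) f = sumP-δ i (f ∘ suc)

_ᵀ : ∀ {m n} → Mat m n → Mat n m
(A ᵀ) i j = A j i

⊗-cong : ∀ {m n k} {A A' : Mat m n} {B B' : Mat n k} →
  A ≈ᴹ A' → B ≈ᴹ B' → A ⊗ B ≈ᴹ A' ⊗ B'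
⊗-cong e f i j = sumP-cong λ l → *P-cong (e i l) (f l j)

⊗-assoc : ∀ {m n k r} (A : Mat m n) (B : Mat n k) (C : Mat k r) → (A ⊗ B) ⊗ C ≈ᴹ A ⊗ (B ⊗ C)
⊗-assoc A B C i j = begin
  sumP (λ l → sumP (λ k → A i k *P B k l) *P C l j)
    ≈⟨ sumP-cong (λ l → *P-distribʳ-sumP (C l j) (λ k → A i k *P B k l)) ⟩
  sumP (λ l → sumP (λ k → A i k *P B k l *P C l j))
    ≈⟨ sumP-comm (λ l k → A i k *P B k l *P C l j) ⟩
  sumP (λ k → sumP (λ l → A i k *P B k l *P C l j))
    ≈⟨ sumP-cong (λ k → sumP-cong (λ l → *P-assoc (A i k) (B k l) (C l j))) ⟩
  sumP (λ k → sumP (λ l → A i k *P (B k l *P C l j)))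
    ≈⟨ sumP-cong (λ k → *P-distribˡ-sumP (A i k) (λ l → B k l *P C l j)) ⟨
  sumP (λ k → A i k *P sumP (λ l → B k l *P C l j))  ∎
  where open ≈-Reasoning

⊗-ᵀ : ∀ {m n k} (A : Mat m n) (B : Mat n k) → (A ⊗ B) ᵀ ≈ᴹ B ᵀ ⊗ A ᵀ
⊗-ᵀ A B i j = sumP-cong λ l → *P-comm (A j l) (B l i)

blockDiag : ∀ {n} → Poly → Mat n n → Mat (suc n) (suc n)
blockDiag c M zero    zero    = c
blockDiag c M zero    (suc j) = 0P
blockDiag c M (suc i) zero    = 0P
blockDiag c M (suc i) (suc j) = M i j

blockDiag-cong : ∀ {n} {a b} {A B : Mat n n} →
  a ≈ b → A ≈ᴹ B → blockDiag a A ≈ᴹ blockDiag b B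
blockDiag-cong a≈b A≈B zero    zero    = a≈b
blockDiag-cong a≈b A≈B zero    (suc j) = ≈-refl
blockDiag-cong a≈b A≈B (suc i) zero    = ≈-refl
blockDiag-cong a≈b A≈B (suc i) (suc j) = A≈B i j

⊗-blockDiag : ∀ {n} a b (A B : Mat n n) →
  blockDiag a A ⊗ blockDiag b B ≈ᴹ blockDiag (a *P b) (A ⊗ B)
⊗-blockDiag {n} a b A B zero    zero    =
  ≈-trans (+P-congˡ (a *P b) (sumP-zero {n} λ _ → ≈-refl)) (+P-identityʳ _)
⊗-blockDiag {n} a b A B zero    (suc j) = +P-cong (*P-zeroʳ a) (sumP-zero {n} λ _ → ≈-refl)
⊗-blockDiag     a b A B (suc i) zero    = sumP-zero λ l → *P-zeroʳ (A i l)
⊗-blockDiag     a b A B (suc i) (suc j) = ≈-refl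

minor : ∀ {m n} → Mat (suc m) (suc n) → Mat m n
minor A i j = A (suc i) (suc j)

IsLowerUnitriangular : ∀ {n} → Mat n n → Set
IsLowerUnitriangular {zero}  L = ⊤
IsLowerUnitriangular {suc n} L =
  L zero zero ≈ 1P × (∀ j → L zero (suc j) ≈ 0P) × IsLowerUnitriangular (minor L)

IsUpperUnitriangular : ∀ {n} → Mat n n → Set
IsUpperUnitriangular U = IsLowerUnitriangular (U ᵀ)

isLowerUnitriangular-resp : ∀ {n} {A B : Mat n n} →
  A ≈ᴹ B → IsLowerUnitriangular A → IsLowerUnitriangular B
isLowerUnitriangular-resp {zero}  A≈B _ = tt
isLowerUnitriangular-resp {suc n} A≈B (a₀₀ , a₀ⱼ , lowerMinor) =
  ≈-trans (≈-sym (A≈B zero zero)) a₀₀ ,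
  (λ j → ≈-trans (≈-sym (A≈B zero (suc j))) (a₀ⱼ j)) ,
  isLowerUnitriangular-resp (λ i j → A≈B (suc i) (suc j)) lowerMinor

⊗-isLowerUnitriangular : ∀ {n} (A B : Mat n n) →
  IsLowerUnitriangular A → IsLowerUnitriangular B → IsLowerUnitriangular (A ⊗ B)
⊗-isLowerUnitriangular {zero}  A B _ _ = tt
⊗-isLowerUnitriangular {suc n} A B (a₀₀ , a₀ⱼ , lowerA) (b₀₀ , b₀ⱼ , lowerB) =
  ≈-trans (+P-cong (*P-cong a₀₀ b₀₀) (sumP-zero λ l → *P-congʳ (B (suc l) zero) (a₀ⱼ l)))
          (+P-identityʳ 1P) ,
  (λ j → +P-cong (≈-trans (*P-congˡ (A zero zero) (b₀ⱼ j)) (*P-zeroʳ (A zero zero)))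
                 (sumP-zero λ l → *P-congʳ (B (suc l) (suc j)) (a₀ⱼ l))) ,
  isLowerUnitriangular-resp minor-⊗ (⊗-isLowerUnitriangular (minor A) (minor B) lowerA lowerB)
  where
  minor-⊗ : minor A ⊗ minor B ≈ᴹ minor (A ⊗ B)
  minor-⊗ i j =
    ≈-sym (+P-congʳ _ (≈-trans (*P-congˡ (A (suc i) zero) (b₀ⱼ j)) (*P-zeroʳ (A (suc i) zero))))

⊗-isUpperUnitriangular : ∀ {n} (A B : Mat n n) →
  IsUpperUnitriangular A → IsUpperUnitriangular B → IsUpperUnitriangular (A ⊗ B)
⊗-isUpperUnitriangular A B upperA upperB =
  isLowerUnitriangular-resp (≈ᴹ-sym (⊗-ᵀ A B)) (⊗-isLowerUnitriangular (B ᵀ) (A ᵀ) upperB upperA)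

blockDiag-isLowerUnitriangular : ∀ {n} (A : Mat n n) →
  IsLowerUnitriangular A → IsLowerUnitriangular (blockDiag 1P A)
blockDiag-isLowerUnitriangular A lowerA = ≈-refl , (λ _ → ≈-refl) , lowerA

blockDiag-isUpperUnitriangular : ∀ {n} (A : Mat n n) →
  IsUpperUnitriangular A → IsUpperUnitriangular (blockDiag 1P A)
blockDiag-isUpperUnitriangular A = blockDiag-isLowerUnitriangular (A ᵀ)

signP-zero : ∀ k {p} → p ≈ 0P → signP k p ≈ 0P
signP-zero zero    p≈0 = p≈0
signP-zero (suc k) p≈0 = -P-cong (signP-zero k p≈0)

det-lowerUnitriangular : ∀ {n} (L : Mat n n) → IsLowerUnitriangular L → det L ≈ 1P
det-lowerUnitriangular {zero}  L _ = ≈-refl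
det-lowerUnitriangular {suc n} L (l₀₀ , l₀ⱼ , lowerMinor) =
  ≈-trans (+P-cong (*P-cong l₀₀ (det-lowerUnitriangular (minor L) lowerMinor))
                   (sumP-zero λ j → signP-zero (toℕ (suc j)) (*P-congʳ _ (l₀ⱼ j))))
          (+P-identityʳ 1P)

det-zeroFirstColumn : ∀ {n} (M : Mat (suc n) (suc n)) → (∀ r → M r zero ≈ 0P) → det M ≈ 0P
det-zeroFirstColumn {zero}  M mᵣ₀ = +P-congʳ 0P (*P-congʳ 1P (mᵣ₀ zero))
det-zeroFirstColumn {suc n} M mᵣ₀ =
  +P-cong (*P-congʳ _ (mᵣ₀ zero)) (sumP-zero λ j → signP-zero (toℕ (suc j)) (expansionTerm j))
  where
  expansionTerm : ∀ j → M zero (suc j) *P det (λ r c → M (suc r) (punchIn (suc j) c)) ≈ 0P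
  expansionTerm j =
    ≈-trans (*P-congˡ (M zero (suc j)) (det-zeroFirstColumn minorⱼ (mᵣ₀ ∘ suc)))
            (*P-zeroʳ (M zero (suc j)))
    where
    minorⱼ : Mat (suc n) (suc n)
    minorⱼ r c = M (suc r) (punchIn (suc j) c)

det-upperUnitriangular : ∀ {n} (U : Mat n n) → IsUpperUnitriangular U → det U ≈ 1P
det-upperUnitriangular {zero}        U _             = ≈-refl
det-upperUnitriangular {suc zero}    U (u₀₀ , _ , _) =
  ≈-trans (+P-identityʳ _) (≈-trans (*P-identityʳ _) u₀₀)
det-upperUnitriangular {suc (suc n)} U (u₀₀ , uᵢ₀ , upperMinor) =
  ≈-trans (+P-cong (*P-cong u₀₀ (det-upperUnitriangular (minor U) upperMinor))
                   (sumP-zero λ j → signP-zero (toℕ (suc j)) (expansionTerm j)))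
          (+P-identityʳ 1P)
  where
  expansionTerm : ∀ j → U zero (suc j) *P det (λ r c → U (suc r) (punchIn (suc j) c)) ≈ 0P
  expansionTerm j =
    ≈-trans (*P-congˡ (U zero (suc j)) (det-zeroFirstColumn minorⱼ uᵢ₀))
            (*P-zeroʳ (U zero (suc j)))
    where
    minorⱼ : Mat (suc n) (suc n)
    minorⱼ r c = U (suc r) (punchIn (suc j) c)

toMat : ∀ {m n} → (ℕ → ℕ → Poly) → Mat m n
toMat f i j = f (toℕ i) (toℕ j)

rowReduce : (ℕ → Poly) → (ℕ → ℕ → Poly) → ℕ → ℕ → Poly
rowReduce c f zero    y = f zero y
rowReduce c f (suc x) y = f (suc x) y +P -P (c x *P f x y)

columnReduce : (ℕ → Poly) → (ℕ → ℕ → Poly) → ℕ → ℕ → Poly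
columnReduce c f x y = rowReduce c (λ y' x' → f x' y') y x

rowReducer : ∀ {n} → (ℕ → Poly) → Mat n n
rowReducer         c zero    j = δ zero j
rowReducer {suc n} c (suc i) j = δ (suc i) j +P -P (c (toℕ i) *P δ (inject₁ i) j)

rowReducer-isLowerUnitriangular : ∀ n c → IsLowerUnitriangular (rowReducer {n} c)
rowReducer-isLowerUnitriangular zero    c = tt
rowReducer-isLowerUnitriangular (suc n) c =
  ≈-refl , (λ _ → ≈-refl) ,
  isLowerUnitriangular-resp minor≈ (rowReducer-isLowerUnitriangular n (c ∘ suc))
  where
  minor≈ : rowReducer (c ∘ suc) ≈ᴹ minor (rowReducer c)
  minor≈ zero    j =
    ≈-sym (≈-trans (+P-congˡ (δ zero j) (-P-cong (*P-zeroʳ (c 0)))) (+P-identityʳ (δ zero j)))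
  minor≈ (suc i) j = ≈-refl

rowReducer-⊗ : ∀ {m n} (c : ℕ → Poly) (f : ℕ → ℕ → Poly) →
  rowReducer {m} c ⊗ toMat {m} {n} f ≈ᴹ toMat (rowReduce c f)
rowReducer-⊗ {suc m} c f zero    j = sumP-δ {suc m} zero (λ l → f (toℕ l) (toℕ j))
rowReducer-⊗ {suc m} c f (suc i) j = begin
  sumP (λ l → (δ (suc i) l +P -P (cᵢ *P δ (inject₁ i) l)) *P F l)
    ≈⟨ sumP-cong (λ l → expand (δ (suc i) l) cᵢ (δ (inject₁ i) l) (F l)) ⟩
  sumP (λ l → δ (suc i) l *P F l +P (-P cᵢ) *P (δ (inject₁ i) l *P F l))
    ≈⟨ sumP-distrib-+P (λ l → δ (suc i) l *P F l) (λ l → (-P cᵢ) *P (δ (inject₁ i) l *P F l)) ⟩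
  sumP (λ l → δ (suc i) l *P F l) +P sumP (λ l → (-P cᵢ) *P (δ (inject₁ i) l *P F l))
    ≈⟨ +P-cong (sumP-δ (suc i) F)
               (≈-trans (≈-sym (*P-distribˡ-sumP (-P cᵢ) (λ l → δ (inject₁ i) l *P F l)))
                        (*P-congˡ (-P cᵢ) (sumP-δ (inject₁ i) F))) ⟩
  F (suc i) +P (-P cᵢ) *P F (inject₁ i)
    ≈⟨ neg-* (F (suc i)) cᵢ (F (inject₁ i)) ⟩
  F (suc i) +P -P (cᵢ *P F (inject₁ i))
    ≡⟨ cong (λ x → F (suc i) +P -P (cᵢ *P f x (toℕ j))) (toℕ-inject₁ i) ⟩
  rowReduce c f (suc (toℕ i)) (toℕ j)  ∎
  where
  open ≈-Reasoning
  cᵢ : Poly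
  cᵢ = c (toℕ i)
  F : Fin (suc m) → Poly
  F l = f (toℕ l) (toℕ j)
  expand : ∀ d c d' a → (d +P -P (c *P d')) *P a ≈ d *P a +P (-P c) *P (d' *P a)
  expand = solve-∀ ℤ[q]-solver
  neg-* : ∀ a c b → a +P (-P c) *P b ≈ a +P -P (c *P b)
  neg-* = solve-∀ ℤ[q]-solver

⊗-rowReducerᵀ : ∀ {m n} (c : ℕ → Poly) (f : ℕ → ℕ → Poly) →
  toMat {m} {n} f ⊗ rowReducer {n} c ᵀ ≈ᴹ toMat (columnReduce c f)
⊗-rowReducerᵀ c f i j =
  ≈-trans (≈-sym (⊗-ᵀ (rowReducer c) (toMat fᵀ) i j)) (rowReducer-⊗ c fᵀ j i)
  where
  fᵀ : ℕ → ℕ → Poly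
  fᵀ y x = f x y

schurMat : ∀ {n} → ℕ → Mat n n
schurMat k = toMat (schur k)

eliminate : ∀ {n} k → let E = rowReducer (multiplier k) in
  (E ⊗ schurMat k) ⊗ E ᵀ ≈ᴹ blockDiag (schur k 0 0) (schurMat {n} (suc k))
eliminate {n} k =
  ≈ᴹ-trans (⊗-cong (rowReducer-⊗ c (schur k)) (≈ᴹ-refl {A = rowReducer c ᵀ}))
           (≈ᴹ-trans (⊗-rowReducerᵀ {suc n} {suc n} c (rowReduce c (schur k))) reduced)
  where
  c : ℕ → Poly
  c = multiplier k
  reduced : toMat (columnReduce c (rowReduce c (schur k))) ≈ᴹ blockDiag (schur k 0 0) (schurMat (suc k))
  reduced zero    zero    = ≈-refl
  reduced (suc i) zero    = rowDifference-zero k (toℕ i)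
  reduced zero    (suc j) = columnDifference-zero k (toℕ j)
  reduced (suc i) (suc j) = doubleDifference-≈ k (toℕ i) (toℕ j)

record TriangularReduction {n} (A D : Mat n n) : Set where
  field
    P Q     : Mat n n
    P-lower : IsLowerUnitriangular P
    Q-upper : IsUpperUnitriangular Q
    PAQ≈D   : (P ⊗ A) ⊗ Q ≈ᴹ D

triangularReduction-resp : ∀ {n} {A D D' : Mat n n} →
  D ≈ᴹ D' → TriangularReduction A D → TriangularReduction A D'
triangularReduction-resp D≈D' r = record
  { P = P ; Q = Q ; P-lower = P-lower ; Q-upper = Q-upper ; PAQ≈D = ≈ᴹ-trans PAQ≈D D≈D' }
  where open TriangularReduction r

⊗-reassoc : ∀ {n} (A B C D E : Mat n n) →
  ((A ⊗ B) ⊗ C) ⊗ (D ⊗ E) ≈ᴹ A ⊗ (((B ⊗ C) ⊗ D) ⊗ E)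
⊗-reassoc A B C D E = begin
  ((A ⊗ B) ⊗ C) ⊗ (D ⊗ E)  ≈⟨ ⊗-cong (⊗-assoc A B C) (≈ᴹ-refl {A = D ⊗ E}) ⟩
  (A ⊗ (B ⊗ C)) ⊗ (D ⊗ E)  ≈⟨ ⊗-assoc A (B ⊗ C) (D ⊗ E) ⟩
  A ⊗ ((B ⊗ C) ⊗ (D ⊗ E))  ≈⟨ ⊗-cong (≈ᴹ-refl {A = A}) (⊗-assoc (B ⊗ C) D E) ⟨
  A ⊗ (((B ⊗ C) ⊗ D) ⊗ E)  ∎
  where open ≈ᴹ-Reasoning

triangularReduction-blockDiag : ∀ {n} {A : Mat (suc n) (suc n)} {A' D' : Mat n n} {d}
  (E F : Mat (suc n) (suc n)) → IsLowerUnitriangular E → IsUpperUnitriangular F →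
  (E ⊗ A) ⊗ F ≈ᴹ blockDiag d A' →
  TriangularReduction A' D' → TriangularReduction A (blockDiag d D')
triangularReduction-blockDiag {n} {A} {A'} {D'} {d} E F E-lower F-upper EAF≈dA' r = record
  { P = P₁ ⊗ E
  ; Q = F ⊗ Q₁
  ; P-lower = ⊗-isLowerUnitriangular P₁ E (blockDiag-isLowerUnitriangular P P-lower) E-lower
  ; Q-upper = ⊗-isUpperUnitriangular F Q₁ F-upper (blockDiag-isUpperUnitriangular Q Q-upper)
  ; PAQ≈D = begin
      ((P₁ ⊗ E) ⊗ A) ⊗ (F ⊗ Q₁)
        ≈⟨ ⊗-reassoc P₁ E A F Q₁ ⟩
      P₁ ⊗ (((E ⊗ A) ⊗ F) ⊗ Q₁)
        ≈⟨ ⊗-cong (≈ᴹ-refl {A = P₁}) (⊗-cong EAF≈dA' (≈ᴹ-refl {A = Q₁})) ⟩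
      P₁ ⊗ (blockDiag d A' ⊗ Q₁)
        ≈⟨ ⊗-cong (≈ᴹ-refl {A = P₁}) (⊗-blockDiag d 1P A' Q) ⟩
      P₁ ⊗ blockDiag (d *P 1P) (A' ⊗ Q)
        ≈⟨ ⊗-blockDiag 1P (d *P 1P) P (A' ⊗ Q) ⟩
      blockDiag (1P *P (d *P 1P)) (P ⊗ (A' ⊗ Q))
        ≈⟨ blockDiag-cong (unit d) P[A'Q]≈D' ⟩
      blockDiag d D'  ∎ }
  where
  open TriangularReduction r
  open ≈ᴹ-Reasoning
  P₁ Q₁ : Mat (suc n) (suc n)
  P₁ = blockDiag 1P P
  Q₁ = blockDiag 1P Q
  P[A'Q]≈D' : P ⊗ (A' ⊗ Q) ≈ᴹ D'
  P[A'Q]≈D' = ≈ᴹ-trans (≈ᴹ-sym (⊗-assoc P A' Q)) PAQ≈D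
  unit : ∀ d → 1P *P (d *P 1P) ≈ d
  unit = solve-∀ ℤ[q]-solver

diagonal : ∀ {n} → (ℕ → Poly) → Mat n n
diagonal d i j = δ i j *P d (toℕ i)

blockDiag-diagonal : ∀ {n} d → blockDiag (d 0) (diagonal {n} (d ∘ suc)) ≈ᴹ diagonal d
blockDiag-diagonal d zero    zero    = ≈-sym (*P-identityˡ (d 0))
blockDiag-diagonal d zero    (suc j) = ≈-refl
blockDiag-diagonal d (suc i) zero    = ≈-refl
blockDiag-diagonal d (suc i) (suc j) = ≈-refl

schurMat-reduction : ∀ n k → TriangularReduction (schurMat {n} k) (diagonal (λ i → schur (i + k) 0 0))
schurMat-reduction zero    k = record
  { P = λ () ; Q = λ () ; P-lower = tt ; Q-upper = tt ; PAQ≈D = λ () }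
schurMat-reduction (suc n) k =
  triangularReduction-resp (≈ᴹ-trans (blockDiag-cong ≈-refl corners) (blockDiag-diagonal corner))
    (triangularReduction-blockDiag E (E ᵀ) E-lower E-lower (eliminate k) (schurMat-reduction n (suc k)))
  where
  corner : ℕ → Poly
  corner i = schur (i + k) 0 0
  E : Mat (suc n) (suc n)
  E = rowReducer (multiplier k)
  E-lower : IsLowerUnitriangular E
  E-lower = rowReducer-isLowerUnitriangular (suc n) (multiplier k)
  corners : diagonal {n} (λ i → schur (i + suc k) 0 0) ≈ᴹ diagonal (λ i → schur (suc i + k) 0 0)
  corners i j = *P-congˡ (δ i j) (≈-reflexive (cong (λ m → schur m 0 0) (ℕ.+-suc (toℕ i) k)))

schur-corner : ∀ k → schur k 0 0 ≈ diagEntry k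
schur-corner k = begin
  qPow (k * k) *P (qPow (k * 0) *P R) *P (qPow (k * 0) *P R) *P 1P
    ≡⟨ cong (λ e → qPow (k * k) *P (qPow e *P R) *P (qPow e *P R) *P 1P) (ℕ.*-zeroʳ k) ⟩
  qPow (k * k) *P (1P *P R) *P (1P *P R) *P 1P
    ≈⟨ simplify (qPow (k * k)) R ⟩
  qPow (k * k) *P (R *P R)
    ≈⟨ *P-congˡ (qPow (k * k)) (*P-cong (≈-sym (qFact≈qRising k)) (≈-sym (qFact≈qRising k))) ⟩
  diagEntry k  ∎
  where
  open ≈-Reasoning
  R : Poly
  R = qRising k 0
  simplify : ∀ s r → s *P (1P *P r) *P (1P *P r) *P 1P ≈ s *P (r *P r)
  simplify = solve-∀ ℤ[q]-solver

factMat≈schurMat : ∀ n → factMat n ≈ᴹ schurMat 0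
factMat≈schurMat n i j = ≈-sym (unit (qFact (toℕ i + toℕ j)))
  where
  unit : ∀ f → 1P *P (1P *P 1P) *P (1P *P 1P) *P f ≈ f
  unit = solve-∀ ℤ[q]-solver

δ-≡ : ∀ {n} {i j : Fin n} → toℕ i ≡ toℕ j → δ i j ≈ 1P
δ-≡ {i = zero}  {zero}  _   = ≈-refl
δ-≡ {i = suc i} {suc j} i≡j = δ-≡ (ℕ.suc-injective i≡j)

δ-≢ : ∀ {n} {i j : Fin n} → ¬ toℕ i ≡ toℕ j → δ i j ≈ 0P
δ-≢ {i = zero}  {zero}  i≢j = ⊥-elim (i≢j refl)
δ-≢ {i = zero}  {suc j} _   = ≈-refl
δ-≢ {i = suc i} {zero}  _   = ≈-refl
δ-≢ {i = suc i} {suc j} i≢j = δ-≢ (i≢j ∘ cong suc)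

diagonal≈diagMat : ∀ n → diagonal (λ i → schur (i + 0) 0 0) ≈ᴹ diagMat n
diagonal≈diagMat n i j with toℕ i ≟ toℕ j
... | yes i≡j =
  ≈-trans (*P-cong (δ-≡ i≡j) corner)
          (≈-trans (*P-identityˡ (schur (toℕ i) 0 0)) (schur-corner (toℕ i)))
  where
  corner : schur (toℕ i + 0) 0 0 ≈ schur (toℕ i) 0 0
  corner = ≈-reflexive (cong (λ m → schur m 0 0) (ℕ.+-identityʳ (toℕ i)))
... | no  i≢j = *P-congʳ (schur (toℕ i + 0) 0 0) (δ-≢ i≢j)

diagMat-diagonal : ∀ n (i j : Fin (suc n)) → toℕ i ≡ toℕ j → diagMat n i j ≈ diagEntry (toℕ i)
diagMat-diagonal n i j i≡j with toℕ i ≟ toℕ j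
... | yes _   = ≈-refl
... | no  i≢j = ⊥-elim (i≢j i≡j)

diagMat-offDiagonal : ∀ n (i j : Fin (suc n)) → ¬ toℕ i ≡ toℕ j → diagMat n i j ≈ 0P
diagMat-offDiagonal n i j i≢j with toℕ i ≟ toℕ j
... | yes i≡j = ⊥-elim (i≢j i≡j)
... | no  _   = ≈-refl

∣P-resp : ∀ {a a' b b'} → a ≈ a' → b ≈ b' → a ∣P b → a' ∣P b'
∣P-resp a≈a' b≈b' (c , b≈ca) =
  c , coeff-≡ (≈-trans (≈-sym b≈b') (≈-trans (mk≈ b≈ca) (*P-congˡ c a≈a')))

diagEntry-∣ : ∀ j t → diagEntry j ∣P diagEntry (j + t)
diagEntry-∣ j t = qPow e *P (qRising t j *P qRising t j) , coeff-≡ (begin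
  qPow ((j + t) * (j + t)) *P (qFact (j + t) *P qFact (j + t))
    ≈⟨ *P-cong qPow-square-+ (*P-cong (qFact-+ j t) (qFact-+ j t)) ⟩
  (qPow (j * j) *P qPow e) *P ((qFact j *P qRising t j) *P (qFact j *P qRising t j))
    ≈⟨ regroup (qPow (j * j)) (qPow e) (qFact j) (qRising t j) ⟩
  (qPow e *P (qRising t j *P qRising t j)) *P diagEntry j  ∎)
  where
  open ≈-Reasoning
  e : ℕ
  e = t * (j + t) + j * t
  square-+ : ∀ j t → (j + t) * (j + t) ≡ j * j + (t * (j + t) + j * t)
  square-+ = ℕ-Solver.solve-∀
  qPow-square-+ : qPow ((j + t) * (j + t)) ≈ qPow (j * j) *P qPow e
  qPow-square-+ = ≈-trans (≈-reflexive (cong qPow (square-+ j t))) (qPow-+ (j * j) e)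
  regroup : ∀ a b f r → (a *P b) *P ((f *P r) *P (f *P r)) ≈ (b *P (r *P r)) *P (a *P (f *P f))
  regroup = solve-∀ ℤ[q]-solver

diagMat-isDiagDivChain : ∀ n → IsDiagDivChain (diagMat n)
diagMat-isDiagDivChain n = (λ i j i≢j → coeff-≡ (diagMat-offDiagonal n i j i≢j)) , divides
  where
  divides : ∀ (i j i' j' : Fin (suc n)) →
            toℕ i ≡ toℕ i' → toℕ j ≡ toℕ j' → toℕ j ≤ toℕ i →
            diagMat n j j' ∣P diagMat n i i'
  divides i j i' j' i≡i' j≡j' j≤i with ℕ.m≤n⇒∃[o]m+o≡n j≤i
  ... | t , j+t≡i =
    ∣P-resp (≈-sym (diagMat-diagonal n j j' j≡j'))
            (≈-trans (≈-reflexive (cong diagEntry j+t≡i)) (≈-sym (diagMat-diagonal n i i' i≡i')))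
            (diagEntry-∣ (toℕ j) t)

corollary4p12 : (n : ℕ) → IsSSNF (factMat n) (diagMat n)
corollary4p12 n =
  P , Q , coeff-≡ (det-lowerUnitriangular P P-lower) , coeff-≡ (det-upperUnitriangular Q Q-upper) ,
  (λ i j → coeff-≡ (PAQ≈diagMat i j)) , diagMat-isDiagDivChain n
  where
  open TriangularReduction (schurMat-reduction (suc n) 0)
  PAQ≈diagMat : (P ⊗ factMat n) ⊗ Q ≈ᴹ diagMat n
  PAQ≈diagMat =
    ≈ᴹ-trans (⊗-cong (⊗-cong (≈ᴹ-refl {A = P}) (factMat≈schurMat n)) (≈ᴹ-refl {A = Q}))
             (≈ᴹ-trans PAQ≈D (diagonal≈diagMat n))
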